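{- For all integers $n\ge0$ and $0\le k\le n$, in the polynomial ring $\mathbb Z[q]$, $$e(n,k)+o(n,k)\,q\equiv q^{\binom{k+1}{2}}\begin{bmatrix}n\\k\end{bmatrix}_q \pmod{q^2-1},\qquad L(n,k)+\bar L(n,k)\,q\equiv\begin{bmatrix}n\\k\end{bmatrix}_q\pmod{q^2-1}.$$
   Context: $e(n,k)$ (resp. $o(n,k)$) is the number of $k$-subsets of $\{1,\dots,n\}$ whose element sum is even (resp. odd); the empty set counts as even. $\begin{bmatrix}n\\k\end{bmatrix}_q=\prod_{i=1}^k\frac{1-q^{n-k+i}}{1-q^i}$ is the Gaussian ($q$-)binomial coefficient. Losanitsch's triangle is defined by $L(0,j)=[j=0]$, $L(1,j)=[0\le j\le 1]$, $L(m,j)=0$ for $j<0$, and for $m\ge 2$ by $L(m,j)=L(m-2,j)+\binom{m-2}{j-1}+L(m-2,j-2)$ (with $\binom{a}{i}=0$ for $i<0$ or $i>a$); and $\bar L(n,k)=\binom nk-L(n,k)$. -}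

module Defs where

open import Data.Nat as ℕ using (ℕ; zero; suc; _∸_)
open import Data.Nat.Combinatorics using (_C_)
open import Data.Integer as ℤ using (ℤ; +_; 0ℤ; 1ℤ)
open import Data.Bool using (Bool; true; false; if_then_else_; _∧_)
open import Data.List using (List; []; _∷_; map; _++_; replicate; length; filter; foldr; upTo)
open import Data.Vec using (Vec; []; _∷_)
open import Data.Product using (Σ; _×_)
open import Relation.Binary.PropositionalEquality using (_≡_)
open import Relation.Nullary.Decidable using (⌊_⌋)

-- Polynomials in ℤ[q], represented by coefficient lists
-- (constant term first); equality is coefficientwise (trailing zeros ignored).

Poly : Set
Poly = List ℤ

coeff : Poly → ℕ → ℤ
coeff []      _       = 0ℤ
coeff (a ∷ p) zero    = a
coeff (a ∷ p) (suc i) = coeff p i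

infix 4 _≈ₚ_
_≈ₚ_ : Poly → Poly → Set
p ≈ₚ r = ∀ i → coeff p i ≡ coeff r i

infixl 6 _+ₚ_ _-ₚ_
infixl 7 _*ₚ_

_+ₚ_ : Poly → Poly → Poly
[]      +ₚ r       = r
(a ∷ p) +ₚ []      = a ∷ p
(a ∷ p) +ₚ (b ∷ r) = (a ℤ.+ b) ∷ (p +ₚ r)

const : ℤ → Poly
const a = a ∷ []

scale : ℤ → Poly → Poly
scale a = map (a ℤ.*_)

negₚ : Poly → Poly
negₚ = map (λ a → ℤ.- a)

_-ₚ_ : Poly → Poly → Poly
p -ₚ r = p +ₚ negₚ r

_*ₚ_ : Poly → Poly → Poly
[]      *ₚ r = []
(a ∷ p) *ₚ r = scale a r +ₚ (0ℤ ∷ (p *ₚ r))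

qpow : ℕ → Poly
qpow n = replicate n 0ℤ ++ (1ℤ ∷ [])

lin : ℤ → ℤ → Poly
lin a b = a ∷ b ∷ []

prodₚ : List Poly → Poly
prodₚ = foldr _*ₚ_ (const 1ℤ)

_∣ₚ_ : Poly → Poly → Set
d ∣ₚ p = Σ Poly (λ h → p ≈ₚ d *ₚ h)

_≡_[modₚ_] : Poly → Poly → Poly → Set
p ≡ r [modₚ m ] = m ∣ₚ (p -ₚ r)

q²-1 : Poly
q²-1 = qpow 2 -ₚ const 1ℤ

-- Gaussian binomial coefficient [n k]_q = ∏_{i=1}^k (1-q^{n-k+i}) / (1-q^i).
-- Since ℤ[q] is an integral domain and the denominator is nonzero, the
-- Gaussian binomial is the unique polynomial G with
--   G * ∏_{i=1}^k (1 - q^i) = ∏_{i=1}^k (1 - q^{n-k+i}).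

oneTo : ℕ → List ℕ
oneTo k = map suc (upTo k)

gaussDen : ℕ → Poly
gaussDen k = prodₚ (map (λ i → const 1ℤ -ₚ qpow i) (oneTo k))

gaussNum : ℕ → ℕ → Poly
gaussNum n k = prodₚ (map (λ i → const 1ℤ -ₚ qpow ((n ∸ k) ℕ.+ i)) (oneTo k))

IsGaussianBinomial : ℕ → ℕ → Poly → Set
IsGaussianBinomial n k G = G *ₚ gaussDen k ≈ₚ gaussNum n k

-- e(n,k), o(n,k): subsets of {1,...,n} as Vec Bool n
-- (position i, 0-based, stands for the element i+1).

allSubsets : (n : ℕ) → List (Vec Bool n)
allSubsets zero    = [] ∷ []
allSubsets (suc n) = map (false ∷_) (allSubsets n) ++ map (true ∷_) (allSubsets n)

card : ∀ {n} → Vec Bool n → ℕ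
card []           = 0
card (false ∷ s)  = card s
card (true ∷ s)   = suc (card s)

-- element sum, with offset: the head position represents element `off`
elemSumFrom : ∀ {n} → ℕ → Vec Bool n → ℕ
elemSumFrom off []          = 0
elemSumFrom off (false ∷ s) = elemSumFrom (suc off) s
elemSumFrom off (true ∷ s)  = off ℕ.+ elemSumFrom (suc off) s

elemSum : ∀ {n} → Vec Bool n → ℕ
elemSum = elemSumFrom 1

isEven : ℕ → Bool
isEven zero          = true
isEven (suc zero)    = false
isEven (suc (suc m)) = isEven m

e o : ℕ → ℕ → ℕ
e n k = length (filter (λ s → card s ℕ.≟ k) (filter (λ s → isEven (elemSum s) Data.Bool.≟ true) (allSubsets n)))
  where import Data.Bool
o n k = length (filter (λ s → card s ℕ.≟ k) (filter (λ s → isEven (elemSum s) Data.Bool.≟ false) (allSubsets n)))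
  where import Data.Bool

L : ℕ → ℕ → ℕ
L zero          zero          = 1
L zero          (suc j)       = 0
L (suc zero)    zero          = 1
L (suc zero)    (suc zero)    = 1
L (suc zero)    (suc (suc j)) = 0
L (suc (suc m)) zero          = L m zero                        -- + C(m,-1) + L(m,-2), both 0
L (suc (suc m)) (suc zero)    = L m 1 ℕ.+ m C 0                 -- + L(m,-1) = 0
L (suc (suc m)) (suc (suc j)) = L m (suc (suc j)) ℕ.+ m C (suc j) ℕ.+ L m j

Lbar : ℕ → ℕ → ℤ
Lbar n k = + (n C k) ℤ.- + (L n k)

-- Next, ℤ[q]/(q²-1) is modelled by ℤ², recording the sums of the even- and of
-- the odd-indexed coefficients: every polynomial is congruent to its image, so
-- polynomials with equal images are congruent, and multiplication by q^m acts
-- on ℤ² by m swaps.  Reducing the q-Pascal recursion twice yields the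
-- recursion of Losanitsch's triangle (second congruence); summing q^(ΣS) over
-- the k-subsets S of {1,...,n}, split by whether they contain 1, yields the
-- same recursion as q^T(k) [n k]_q, while its two components count the
-- subsets of even and of odd sum (first congruence).

module Submission where

open import Defs
open import Level using (0ℓ)
open import Data.Nat as ℕ using (ℕ; zero; suc; _∸_; _≤_)
import Data.Nat.Properties as ℕP
open import Data.Nat.Combinatorics using (_C_; nCk+nC[k+1]≡[n+1]C[k+1]; nC1≡n)
open import Data.Integer as ℤ using (ℤ; +_; 0ℤ; 1ℤ)
import Data.Integer.Properties as ℤP
import Data.Integer.Tactic.RingSolver as ℤ-Solver
open import Tactic.RingSolver using (solve-∀)
open import Tactic.RingSolver.Core.AlmostCommutativeRing using (AlmostCommutativeRing; fromCommutativeRing)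
open import Relation.Nullary using (yes)
open import Data.List using (List; []; _∷_; map; _++_; filter; length)
open import Data.Vec using (Vec; []; _∷_)
open import Data.Bool as B using (Bool; true; false; if_then_else_)
open import Data.Bool.Properties using (T-≡)
open import Function.Bundles using (Equivalence)
import Data.List.Properties as LP
open import Function using (id; _∘_)
open import Data.Product using (Σ; _×_; _,_; proj₁; proj₂; swap)
open import Data.Maybe using (Maybe; just; nothing)
open import Relation.Binary.PropositionalEquality
open import Relation.Binary.Bundles using (Setoid)
open import Relation.Binary.Structures using (IsEquivalence)
open import Algebra.Bundles using (AbelianGroup; CommutativeRing)
import Relation.Binary.Reasoning.Setoid
import Algebra.Properties.CommutativeSemigroup
import Algebra.Properties.AbelianGroup

-- It is wrapped in a record so
-- that both polynomials can be recovered from a proof (the bare function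
-- type  p ≈ₚ r  does not determine p and r, which defeats inference).
infix 4 _≋_
record _≋_ (p r : Poly) : Set where
  constructor coeffwise
  field coeff-≡ : p ≈ₚ r
open _≋_

≋-isEquivalence : IsEquivalence _≋_
≋-isEquivalence = record
  { refl  = coeffwise λ _ → refl
  ; sym   = λ (coeffwise h) → coeffwise λ i → sym (h i)
  ; trans = λ (coeffwise h) (coeffwise g) → coeffwise λ i → trans (h i) (g i)
  }

≋-setoid : Setoid 0ℓ 0ℓ
≋-setoid = record { isEquivalence = ≋-isEquivalence }

open IsEquivalence ≋-isEquivalence using ()
  renaming (refl to ≋-refl; sym to ≋-sym; trans to ≋-trans; reflexive to ≋-reflexive)

module ≋ = Relation.Binary.Reasoning.Setoid ≋-setoid

one : Poly
one = const 1ℤ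

∷-cong : ∀ {a b p r} → a ≡ b → p ≋ r → a ∷ p ≋ b ∷ r
∷-cong a≡b (coeffwise h) = coeffwise λ { zero → a≡b ; (suc i) → h i }

∷-inj : ∀ {a b p r} → a ∷ p ≋ b ∷ r → a ≡ b × p ≋ r
∷-inj (coeffwise h) = h 0 , coeffwise (λ i → h (suc i))

[]≋0∷ : ∀ {p} → [] ≋ p → [] ≋ 0ℤ ∷ p
[]≋0∷ (coeffwise h) = coeffwise λ { zero → refl ; (suc i) → h i }

[]≋∷-inj : ∀ {b r} → [] ≋ b ∷ r → 0ℤ ≡ b × [] ≋ r
[]≋∷-inj (coeffwise h) = h 0 , coeffwise (λ i → h (suc i))

coeff-+ : ∀ p r i → coeff (p +ₚ r) i ≡ coeff p i ℤ.+ coeff r i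
coeff-+ []      r       i       = sym (ℤP.+-identityˡ _)
coeff-+ (a ∷ p) []      i       = sym (ℤP.+-identityʳ _)
coeff-+ (a ∷ p) (b ∷ r) zero    = refl
coeff-+ (a ∷ p) (b ∷ r) (suc i) = coeff-+ p r i

coeff-neg : ∀ p i → coeff (negₚ p) i ≡ ℤ.- coeff p i
coeff-neg []      i       = refl
coeff-neg (a ∷ p) zero    = refl
coeff-neg (a ∷ p) (suc i) = coeff-neg p i

coeff-scale : ∀ a p i → coeff (scale a p) i ≡ a ℤ.* coeff p i
coeff-scale a []      i       = sym (ℤP.*-zeroʳ a)
coeff-scale a (b ∷ p) zero    = refl
coeff-scale a (b ∷ p) (suc i) = coeff-scale a p i

+ₚ-cong : ∀ {p p′ r r′} → p ≋ p′ → r ≋ r′ → p +ₚ r ≋ p′ +ₚ r′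
+ₚ-cong {p} {p′} {r} {r′} (coeffwise h) (coeffwise g) = coeffwise λ i →
  trans (coeff-+ p r i) (trans (cong₂ ℤ._+_ (h i) (g i)) (sym (coeff-+ p′ r′ i)))

+ₚ-comm : ∀ p r → p +ₚ r ≋ r +ₚ p
+ₚ-comm p r = coeffwise λ i →
  trans (coeff-+ p r i) (trans (ℤP.+-comm (coeff p i) (coeff r i)) (sym (coeff-+ r p i)))

+ₚ-assoc : ∀ p r s → (p +ₚ r) +ₚ s ≋ p +ₚ (r +ₚ s)
+ₚ-assoc p r s = coeffwise λ i → begin
  coeff ((p +ₚ r) +ₚ s) i                   ≡⟨ coeff-+ (p +ₚ r) s i ⟩
  coeff (p +ₚ r) i ℤ.+ coeff s i            ≡⟨ cong (ℤ._+ coeff s i) (coeff-+ p r i) ⟩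
  coeff p i ℤ.+ coeff r i ℤ.+ coeff s i     ≡⟨ ℤP.+-assoc (coeff p i) (coeff r i) (coeff s i) ⟩
  coeff p i ℤ.+ (coeff r i ℤ.+ coeff s i)   ≡⟨ cong (λ x → coeff p i ℤ.+ x) (coeff-+ r s i) ⟨
  coeff p i ℤ.+ coeff (r +ₚ s) i            ≡⟨ coeff-+ p (r +ₚ s) i ⟨
  coeff (p +ₚ (r +ₚ s)) i                   ∎
  where open ≡-Reasoning

+ₚ-identityʳ : ∀ p → p +ₚ [] ≋ p
+ₚ-identityʳ p = coeffwise λ i → trans (coeff-+ p [] i) (ℤP.+-identityʳ (coeff p i))

negₚ-cong : ∀ {p p′} → p ≋ p′ → negₚ p ≋ negₚ p′
negₚ-cong {p} {p′} (coeffwise h) = coeffwise λ i →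
  trans (coeff-neg p i) (trans (cong ℤ.-_ (h i)) (sym (coeff-neg p′ i)))

+ₚ-inverseʳ : ∀ p → p +ₚ negₚ p ≋ []
+ₚ-inverseʳ p = coeffwise λ i →
  trans (coeff-+ p (negₚ p) i)
        (trans (cong (λ x → coeff p i ℤ.+ x) (coeff-neg p i)) (ℤP.+-inverseʳ (coeff p i)))

+ₚ-abelianGroup : AbelianGroup 0ℓ 0ℓ
+ₚ-abelianGroup = record
  { Carrier = Poly ; _≈_ = _≋_ ; _∙_ = _+ₚ_ ; ε = [] ; _⁻¹ = negₚ
  ; isAbelianGroup = record
    { isGroup = record
      { isMonoid = record
        { isSemigroup = record
          { isMagma = record { isEquivalence = ≋-isEquivalence ; ∙-cong = +ₚ-cong }
          ; assoc   = +ₚ-assoc }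
        ; identity = (λ _ → ≋-refl) , +ₚ-identityʳ }
      ; inverse = (λ p → ≋-trans (+ₚ-comm (negₚ p) p) (+ₚ-inverseʳ p)) , +ₚ-inverseʳ
      ; ⁻¹-cong = negₚ-cong }
    ; comm = +ₚ-comm } }

open Algebra.Properties.CommutativeSemigroup (AbelianGroup.commutativeSemigroup +ₚ-abelianGroup)
  using (interchange; x∙yz≈y∙xz)
open Algebra.Properties.CommutativeSemigroup ℤP.+-commutativeSemigroup
  using () renaming (interchange to ℤ-interchange)
open Algebra.Properties.AbelianGroup ℤP.+-0-abelianGroup using (xyx⁻¹≈y)
open Algebra.Properties.CommutativeSemigroup ℕP.+-commutativeSemigroup
  using () renaming (x∙yz≈y∙xz to ℕ-x+[y+z]≡y+[x+z])

scale-cong : ∀ {a b p r} → a ≡ b → p ≋ r → scale a p ≋ scale b r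
scale-cong {a} {b} {p} {r} refl (coeffwise h) = coeffwise λ i →
  trans (coeff-scale a p i) (trans (cong (a ℤ.*_) (h i)) (sym (coeff-scale a r i)))

scale-distribˡ : ∀ a p r → scale a (p +ₚ r) ≋ scale a p +ₚ scale a r
scale-distribˡ a p r = coeffwise λ i → begin
  coeff (scale a (p +ₚ r)) i                      ≡⟨ coeff-scale a (p +ₚ r) i ⟩
  a ℤ.* coeff (p +ₚ r) i                          ≡⟨ cong (a ℤ.*_) (coeff-+ p r i) ⟩
  a ℤ.* (coeff p i ℤ.+ coeff r i)                 ≡⟨ ℤP.*-distribˡ-+ a (coeff p i) (coeff r i) ⟩
  a ℤ.* coeff p i ℤ.+ a ℤ.* coeff r i             ≡⟨ cong₂ ℤ._+_ (coeff-scale a p i) (coeff-scale a r i) ⟨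
  coeff (scale a p) i ℤ.+ coeff (scale a r) i     ≡⟨ coeff-+ (scale a p) (scale a r) i ⟨
  coeff (scale a p +ₚ scale a r) i                ∎
  where open ≡-Reasoning

scale-distribʳ : ∀ a b p → scale (a ℤ.+ b) p ≋ scale a p +ₚ scale b p
scale-distribʳ a b p = coeffwise λ i → begin
  coeff (scale (a ℤ.+ b) p) i                     ≡⟨ coeff-scale (a ℤ.+ b) p i ⟩
  (a ℤ.+ b) ℤ.* coeff p i                         ≡⟨ ℤP.*-distribʳ-+ (coeff p i) a b ⟩
  a ℤ.* coeff p i ℤ.+ b ℤ.* coeff p i             ≡⟨ cong₂ ℤ._+_ (coeff-scale a p i) (coeff-scale b p i) ⟨
  coeff (scale a p) i ℤ.+ coeff (scale b p) i     ≡⟨ coeff-+ (scale a p) (scale b p) i ⟨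
  coeff (scale a p +ₚ scale b p) i                ∎
  where open ≡-Reasoning

scale-assoc : ∀ a b p → scale (a ℤ.* b) p ≋ scale a (scale b p)
scale-assoc a b p = coeffwise λ i → begin
  coeff (scale (a ℤ.* b) p) i                     ≡⟨ coeff-scale (a ℤ.* b) p i ⟩
  a ℤ.* b ℤ.* coeff p i                           ≡⟨ ℤP.*-assoc a b (coeff p i) ⟩
  a ℤ.* (b ℤ.* coeff p i)                         ≡⟨ cong (a ℤ.*_) (coeff-scale b p i) ⟨
  a ℤ.* coeff (scale b p) i                       ≡⟨ coeff-scale a (scale b p) i ⟨
  coeff (scale a (scale b p)) i                   ∎
  where open ≡-Reasoning

scale-zero : ∀ p → scale 0ℤ p ≋ []
scale-zero p = coeffwise λ i → trans (coeff-scale 0ℤ p i) (ℤP.*-zeroˡ (coeff p i))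

scale-one : ∀ p → scale 1ℤ p ≋ p
scale-one p = coeffwise λ i → trans (coeff-scale 1ℤ p i) (ℤP.*-identityˡ (coeff p i))

*ₚ-zeroˡ : ∀ {p} r → [] ≋ p → [] ≋ p *ₚ r
*ₚ-zeroˡ {[]}    r _  = ≋-refl
*ₚ-zeroˡ {a ∷ p} r z with []≋∷-inj z
... | refl , z′ = ≋.begin
  []                               ≋.≈⟨ []≋0∷ (*ₚ-zeroˡ r z′) ⟩
  0ℤ ∷ (p *ₚ r)                    ≋.≈⟨ +ₚ-cong (scale-zero r) ≋-refl ⟨
  scale 0ℤ r +ₚ (0ℤ ∷ (p *ₚ r))    ≋.∎

*ₚ-congʳ : ∀ {p p′} r → p ≋ p′ → p *ₚ r ≋ p′ *ₚ r
*ₚ-congʳ {[]}    {p′}     r h = *ₚ-zeroˡ r h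
*ₚ-congʳ {a ∷ p} {[]}     r h = ≋-sym (*ₚ-zeroˡ r (≋-sym h))
*ₚ-congʳ {a ∷ p} {b ∷ p′} r h with ∷-inj h
... | a≡b , p≋p′ = +ₚ-cong (scale-cong a≡b ≋-refl) (∷-cong refl (*ₚ-congʳ r p≋p′))

*ₚ-zeroʳ : ∀ p → p *ₚ [] ≋ []
*ₚ-zeroʳ []      = ≋-refl
*ₚ-zeroʳ (a ∷ p) = ≋-sym ([]≋0∷ (≋-sym (*ₚ-zeroʳ p)))

*ₚ-distribʳ : ∀ s p r → (p +ₚ r) *ₚ s ≋ p *ₚ s +ₚ r *ₚ s
*ₚ-distribʳ s []      r       = ≋-refl
*ₚ-distribʳ s (a ∷ p) []      = ≋-sym (+ₚ-identityʳ ((a ∷ p) *ₚ s))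
*ₚ-distribʳ s (a ∷ p) (b ∷ r) = ≋.begin
  scale (a ℤ.+ b) s +ₚ (0ℤ ∷ ((p +ₚ r) *ₚ s))
    ≋.≈⟨ +ₚ-cong (scale-distribʳ a b s) (∷-cong refl (*ₚ-distribʳ s p r)) ⟩
  (scale a s +ₚ scale b s) +ₚ ((0ℤ ∷ (p *ₚ s)) +ₚ (0ℤ ∷ (r *ₚ s)))
    ≋.≈⟨ interchange (scale a s) (scale b s) (0ℤ ∷ (p *ₚ s)) (0ℤ ∷ (r *ₚ s)) ⟩
  (scale a s +ₚ (0ℤ ∷ (p *ₚ s))) +ₚ (scale b s +ₚ (0ℤ ∷ (r *ₚ s)))
    ≋.∎

*ₚ-∷ʳ : ∀ p b r → p *ₚ (b ∷ r) ≋ scale b p +ₚ (0ℤ ∷ (p *ₚ r))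
*ₚ-∷ʳ []      b r = []≋0∷ ≋-refl
*ₚ-∷ʳ (a ∷ p) b r = ∷-cong (cong (ℤ._+ 0ℤ) (ℤP.*-comm a b)) (≋.begin
  scale a r +ₚ p *ₚ (b ∷ r)                     ≋.≈⟨ +ₚ-cong ≋-refl (*ₚ-∷ʳ p b r) ⟩
  scale a r +ₚ (scale b p +ₚ (0ℤ ∷ (p *ₚ r)))   ≋.≈⟨ x∙yz≈y∙xz (scale a r) (scale b p) _ ⟩
  scale b p +ₚ (scale a r +ₚ (0ℤ ∷ (p *ₚ r)))   ≋.∎)

*ₚ-comm : ∀ p r → p *ₚ r ≋ r *ₚ p
*ₚ-comm []      r = ≋-sym (*ₚ-zeroʳ r)
*ₚ-comm (a ∷ p) r = ≋-trans (+ₚ-cong ≋-refl (∷-cong refl (*ₚ-comm p r))) (≋-sym (*ₚ-∷ʳ r a p))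

scale-*ₚ : ∀ a p s → scale a p *ₚ s ≋ scale a (p *ₚ s)
scale-*ₚ a []      s = ≋-refl
scale-*ₚ a (b ∷ p) s = ≋.begin
  scale (a ℤ.* b) s +ₚ (0ℤ ∷ (scale a p *ₚ s))
    ≋.≈⟨ +ₚ-cong (scale-assoc a b s) (∷-cong (sym (ℤP.*-zeroʳ a)) (scale-*ₚ a p s)) ⟩
  scale a (scale b s) +ₚ scale a (0ℤ ∷ (p *ₚ s))
    ≋.≈⟨ scale-distribˡ a (scale b s) (0ℤ ∷ (p *ₚ s)) ⟨
  scale a (scale b s +ₚ (0ℤ ∷ (p *ₚ s)))
    ≋.∎

shift-*ₚ : ∀ p s → (0ℤ ∷ p) *ₚ s ≋ 0ℤ ∷ (p *ₚ s)
shift-*ₚ p s = +ₚ-cong (scale-zero s) ≋-refl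

*ₚ-assoc : ∀ p r s → (p *ₚ r) *ₚ s ≋ p *ₚ (r *ₚ s)
*ₚ-assoc []      r s = ≋-refl
*ₚ-assoc (a ∷ p) r s = ≋.begin
  (scale a r +ₚ (0ℤ ∷ (p *ₚ r))) *ₚ s
    ≋.≈⟨ *ₚ-distribʳ s (scale a r) (0ℤ ∷ (p *ₚ r)) ⟩
  scale a r *ₚ s +ₚ (0ℤ ∷ (p *ₚ r)) *ₚ s
    ≋.≈⟨ +ₚ-cong (scale-*ₚ a r s) (≋-trans (shift-*ₚ (p *ₚ r) s) (∷-cong refl (*ₚ-assoc p r s))) ⟩
  scale a (r *ₚ s) +ₚ (0ℤ ∷ (p *ₚ (r *ₚ s)))
    ≋.∎

*ₚ-identityˡ : ∀ p → one *ₚ p ≋ p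
*ₚ-identityˡ p = ≋-trans (+ₚ-cong (scale-one p) (≋-sym ([]≋0∷ ≋-refl))) (+ₚ-identityʳ p)

ℤ[q] : CommutativeRing 0ℓ 0ℓ
ℤ[q] = record
  { Carrier = Poly ; _≈_ = _≋_ ; _+_ = _+ₚ_ ; _*_ = _*ₚ_ ; -_ = negₚ ; 0# = [] ; 1# = one
  ; isCommutativeRing = record
    { isRing = record
      { +-isAbelianGroup = AbelianGroup.isAbelianGroup +ₚ-abelianGroup
      ; *-cong = λ {p} {p′} {r} {r′} p≋p′ r≋r′ → ≋.begin
          p *ₚ r   ≋.≈⟨ *ₚ-congʳ r p≋p′ ⟩
          p′ *ₚ r  ≋.≈⟨ *ₚ-comm p′ r ⟩
          r *ₚ p′  ≋.≈⟨ *ₚ-congʳ p′ r≋r′ ⟩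
          r′ *ₚ p′ ≋.≈⟨ *ₚ-comm r′ p′ ⟩
          p′ *ₚ r′ ≋.∎
      ; *-assoc = *ₚ-assoc
      ; *-identity = *ₚ-identityˡ , λ p → ≋-trans (*ₚ-comm p one) (*ₚ-identityˡ p)
      ; distrib = (λ s p r → ≋.begin
                     s *ₚ (p +ₚ r)         ≋.≈⟨ *ₚ-comm s (p +ₚ r) ⟩
                     (p +ₚ r) *ₚ s         ≋.≈⟨ *ₚ-distribʳ s p r ⟩
                     p *ₚ s +ₚ r *ₚ s      ≋.≈⟨ +ₚ-cong (*ₚ-comm p s) (*ₚ-comm r s) ⟩
                     s *ₚ p +ₚ s *ₚ r      ≋.∎)
                , *ₚ-distribʳ }
    ; *-comm = *ₚ-comm } }

module CR = CommutativeRing ℤ[q]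

ℤ[q]-solver : AlmostCommutativeRing 0ℓ 0ℓ
ℤ[q]-solver = fromCommutativeRing ℤ[q] isZero
  where
  isZero : ∀ p → Maybe ([] ≋ p)
  isZero []      = just ≋-refl
  isZero (a ∷ p) with a ℤ.≟ 0ℤ | isZero p
  ... | yes refl | just z = just ([]≋0∷ z)
  ... | _        | _      = nothing

qPascal-step : ∀ g₁ g₂ d a Q P → g₁ *ₚ d ≋ a → g₂ *ₚ (d *ₚ (one -ₚ Q)) ≋ (one -ₚ P) *ₚ a →
               (g₁ +ₚ Q *ₚ g₂) *ₚ (d *ₚ (one -ₚ Q)) ≋ a *ₚ (one -ₚ Q *ₚ P)
qPascal-step g₁ g₂ d a Q P lower upper = ≋.begin
  (g₁ +ₚ Q *ₚ g₂) *ₚ (d *ₚ (one -ₚ Q))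
    ≋.≈⟨ expand g₁ g₂ d Q ⟩
  (g₁ *ₚ d) *ₚ (one -ₚ Q) +ₚ Q *ₚ (g₂ *ₚ (d *ₚ (one -ₚ Q)))
    ≋.≈⟨ +ₚ-cong (CR.*-cong lower ≋-refl) (CR.*-cong (≋-refl {Q}) upper) ⟩
  a *ₚ (one -ₚ Q) +ₚ Q *ₚ ((one -ₚ P) *ₚ a)
    ≋.≈⟨ collect a Q P ⟩
  a *ₚ (one -ₚ Q *ₚ P)
    ≋.∎
  where
  expand : ∀ g₁ g₂ d Q → (g₁ +ₚ Q *ₚ g₂) *ₚ (d *ₚ (one +ₚ negₚ Q))
                       ≋ (g₁ *ₚ d) *ₚ (one +ₚ negₚ Q) +ₚ Q *ₚ (g₂ *ₚ (d *ₚ (one +ₚ negₚ Q)))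
  expand = solve-∀ ℤ[q]-solver
  collect : ∀ a Q P → a *ₚ (one +ₚ negₚ Q) +ₚ Q *ₚ ((one +ₚ negₚ P) *ₚ a) ≋ a *ₚ (one +ₚ negₚ (Q *ₚ P))
  collect = solve-∀ ℤ[q]-solver

-- The factor 1 - q^m, and the product ∏_{i=1}^k (1 - q^(a+i)).  Both the
-- numerator (a = n-k) and the denominator (a = 0) of [n k]_q have this form.
1-q^ : ℕ → Poly
1-q^ m = one -ₚ qpow m

shiftedProd : ℕ → ℕ → Poly
shiftedProd a k = prodₚ (map (λ i → 1-q^ (a ℕ.+ i)) (oneTo k))

oneTo-suc : ∀ k → oneTo (suc k) ≡ 1 ∷ map suc (oneTo k)
oneTo-suc k = cong (λ is → 1 ∷ map suc is) (sym (LP.map-applyUpTo id suc k))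

shiftedProd-first : ∀ a k → shiftedProd a (suc k) ≡ 1-q^ (suc a) *ₚ shiftedProd (suc a) k
shiftedProd-first a k = begin
  shiftedProd a (suc k)
    ≡⟨ cong (prodₚ ∘ map factor) (oneTo-suc k) ⟩
  factor 1 *ₚ prodₚ (map factor (map suc (oneTo k)))
    ≡⟨ cong₂ (λ m fs → 1-q^ m *ₚ prodₚ fs) (ℕP.+-comm a 1) (sym (LP.map-∘ (oneTo k))) ⟩
  1-q^ (suc a) *ₚ prodₚ (map (factor ∘ suc) (oneTo k))
    ≡⟨ cong (λ fs → 1-q^ (suc a) *ₚ prodₚ fs) (LP.map-cong (λ i → cong 1-q^ (ℕP.+-suc a i)) (oneTo k)) ⟩
  1-q^ (suc a) *ₚ shiftedProd (suc a) k
    ∎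
  where
  open ≡-Reasoning
  factor : ℕ → Poly
  factor i = 1-q^ (a ℕ.+ i)

shiftedProd-last : ∀ a k → shiftedProd a (suc k) ≋ shiftedProd a k *ₚ 1-q^ (a ℕ.+ suc k)
shiftedProd-last a zero    = *ₚ-comm (1-q^ (a ℕ.+ 1)) one
shiftedProd-last a (suc k) = ≋.begin
  shiftedProd a (suc (suc k))
    ≋.≡⟨ shiftedProd-first a (suc k) ⟩
  1-q^ (suc a) *ₚ shiftedProd (suc a) (suc k)
    ≋.≈⟨ CR.*-cong (≋-refl {1-q^ (suc a)}) (shiftedProd-last (suc a) k) ⟩
  1-q^ (suc a) *ₚ (shiftedProd (suc a) k *ₚ 1-q^ (suc a ℕ.+ suc k))
    ≋.≈⟨ *ₚ-assoc (1-q^ (suc a)) (shiftedProd (suc a) k) _ ⟨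
  (1-q^ (suc a) *ₚ shiftedProd (suc a) k) *ₚ 1-q^ (suc a ℕ.+ suc k)
    ≋.≡⟨ cong₂ _*ₚ_ (sym (shiftedProd-first a k)) (cong 1-q^ (sym (ℕP.+-suc a (suc k)))) ⟩
  shiftedProd a (suc k) *ₚ 1-q^ (a ℕ.+ suc (suc k))
    ≋.∎

qpow-+ : ∀ a b → qpow a *ₚ qpow b ≋ qpow (a ℕ.+ b)
qpow-+ zero    b = *ₚ-identityˡ (qpow b)
qpow-+ (suc a) b = ≋-trans (shift-*ₚ (qpow a) (qpow b)) (∷-cong refl (qpow-+ a b))

1-q^0≋0 : 1-q^ 0 ≋ []
1-q^0≋0 = +ₚ-inverseʳ one

gauss : ℕ → ℕ → Poly
gauss n       zero    = one
gauss zero    (suc k) = []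
gauss (suc n) (suc k) = gauss n k +ₚ qpow (suc k) *ₚ gauss n (suc k)

gauss-vanishes : ∀ {n k} → n ℕ.< k → gauss n k ≋ []
gauss-vanishes {zero}  {suc k} _ = ≋-refl
gauss-vanishes {suc n} {suc k} (ℕ.s≤s n<k) = ≋.begin
  gauss n k +ₚ qpow (suc k) *ₚ gauss n (suc k)
    ≋.≈⟨ +ₚ-cong (gauss-vanishes n<k) (CR.*-cong (≋-refl {qpow (suc k)}) (gauss-vanishes (ℕP.m≤n⇒m≤1+n n<k))) ⟩
  qpow (suc k) *ₚ []
    ≋.≈⟨ *ₚ-zeroʳ (qpow (suc k)) ⟩
  []
    ≋.∎

gauss-product : ∀ a k → gauss (k ℕ.+ a) k *ₚ shiftedProd 0 k ≋ shiftedProd a k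

-- The companion identity for the second summand of the q-Pascal recursion;
-- for a = 0 both sides vanish, since [k k+1] = 0 and 1 - q^0 = 0.
gauss-product-above : ∀ a k → gauss (k ℕ.+ a) (suc k) *ₚ shiftedProd 0 (suc k) ≋ 1-q^ a *ₚ shiftedProd a k
gauss-product-above zero k = ≋.begin
  gauss (k ℕ.+ 0) (suc k) *ₚ shiftedProd 0 (suc k)
    ≋.≈⟨ *ₚ-congʳ (shiftedProd 0 (suc k)) (gauss-vanishes (ℕ.s≤s (ℕP.≤-reflexive (ℕP.+-identityʳ k)))) ⟩
  []
    ≋.≈⟨ *ₚ-zeroˡ (shiftedProd 0 k) (≋-sym 1-q^0≋0) ⟩
  1-q^ 0 *ₚ shiftedProd 0 k
    ≋.∎
gauss-product-above (suc a) k = ≋.begin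
  gauss (k ℕ.+ suc a) (suc k) *ₚ shiftedProd 0 (suc k)
    ≋.≡⟨ cong (λ m → gauss m (suc k) *ₚ shiftedProd 0 (suc k)) (ℕP.+-suc k a) ⟩
  gauss (suc k ℕ.+ a) (suc k) *ₚ shiftedProd 0 (suc k)
    ≋.≈⟨ gauss-product a (suc k) ⟩
  shiftedProd a (suc k)
    ≋.≡⟨ shiftedProd-first a k ⟩
  1-q^ (suc a) *ₚ shiftedProd (suc a) k
    ≋.∎

gauss-product a zero    = *ₚ-identityˡ one
gauss-product a (suc k) = ≋.begin
  (gauss (k ℕ.+ a) k +ₚ qpow (suc k) *ₚ gauss (k ℕ.+ a) (suc k)) *ₚ shiftedProd 0 (suc k)
    ≋.≈⟨ CR.*-cong (≋-refl {gauss (suc k ℕ.+ a) (suc k)}) (shiftedProd-last 0 k) ⟩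
  (gauss (k ℕ.+ a) k +ₚ qpow (suc k) *ₚ gauss (k ℕ.+ a) (suc k)) *ₚ (shiftedProd 0 k *ₚ 1-q^ (suc k))
    ≋.≈⟨ qPascal-step (gauss (k ℕ.+ a) k) (gauss (k ℕ.+ a) (suc k)) (shiftedProd 0 k) (shiftedProd a k)
                       (qpow (suc k)) (qpow a) (gauss-product a k) above ⟩
  shiftedProd a k *ₚ (one -ₚ qpow (suc k) *ₚ qpow a)
    ≋.≈⟨ CR.*-cong (≋-refl {shiftedProd a k}) (+ₚ-cong (≋-refl {one}) (negₚ-cong exponent)) ⟩
  shiftedProd a k *ₚ 1-q^ (a ℕ.+ suc k)
    ≋.≈⟨ shiftedProd-last a k ⟨
  shiftedProd a (suc k)
    ≋.∎
  where
  above : gauss (k ℕ.+ a) (suc k) *ₚ (shiftedProd 0 k *ₚ 1-q^ (suc k)) ≋ 1-q^ a *ₚ shiftedProd a k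
  above = ≋-trans (CR.*-cong (≋-refl {gauss (k ℕ.+ a) (suc k)}) (≋-sym (shiftedProd-last 0 k))) (gauss-product-above a k)
  exponent : qpow (suc k) *ₚ qpow a ≋ qpow (a ℕ.+ suc k)
  exponent = ≋-trans (qpow-+ (suc k) a) (≋-reflexive (cong qpow (ℕP.+-comm (suc k) a)))

gauss-isGaussianBinomial : ∀ {n k} → k ≤ n → IsGaussianBinomial n k (gauss n k)
gauss-isGaussianBinomial {n} {k} k≤n =
  coeff-≡ (subst (λ m → gauss m k *ₚ gaussDen k ≋ gaussNum n k)
                 (ℕP.m+[n∸m]≡n k≤n) (gauss-product (n ∸ k) k))

-- ℤ[q]/(q²-1) is modelled by ℤ², a class being recorded by the sums of its
-- even- and of its odd-indexed coefficients; multiplication by q swaps them.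
ℤ² : Set
ℤ² = ℤ × ℤ

0² : ℤ²
0² = 0ℤ , 0ℤ

infixl 6 _⊕_
_⊕_ : ℤ² → ℤ² → ℤ²
(a , b) ⊕ (c , d) = a ℤ.+ c , b ℤ.+ d

q^_·_ : ℕ → ℤ² → ℤ²
q^ zero  · x = x
q^ suc m · x = swap (q^ m · x)

-- Since q² = 1, the constant term joins the even part and the rest is swapped.
reduce : Poly → ℤ²
reduce []      = 0²
reduce (a ∷ p) = a ℤ.+ proj₂ (reduce p) , proj₁ (reduce p)

reduceₚ : Poly → Poly
reduceₚ p = lin (proj₁ (reduce p)) (proj₂ (reduce p))

reduce-zero : ∀ {p} → [] ≋ p → reduce p ≡ 0²
reduce-zero {[]}    _ = refl
reduce-zero {a ∷ p} z with []≋∷-inj z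
... | refl , z′ = cong (λ x → 0ℤ ℤ.+ proj₂ x , proj₁ x) (reduce-zero z′)

reduce-cong : ∀ {p r} → p ≋ r → reduce p ≡ reduce r
reduce-cong {[]}    {r}     h = sym (reduce-zero h)
reduce-cong {a ∷ p} {[]}    h = reduce-zero (≋-sym h)
reduce-cong {a ∷ p} {b ∷ r} h with ∷-inj h
... | refl , p≋r = cong (λ x → a ℤ.+ proj₂ x , proj₁ x) (reduce-cong p≋r)

reduce-+ : ∀ p r → reduce (p +ₚ r) ≡ reduce p ⊕ reduce r
reduce-+ []      r       = cong₂ _,_ (sym (ℤP.+-identityˡ _)) (sym (ℤP.+-identityˡ _))
reduce-+ (a ∷ p) []      = cong₂ _,_ (sym (ℤP.+-identityʳ _)) (sym (ℤP.+-identityʳ _))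
reduce-+ (a ∷ p) (b ∷ r) rewrite reduce-+ p r =
  cong₂ _,_ (ℤ-interchange a b (proj₂ (reduce p)) (proj₂ (reduce r))) refl

reduce-lin : ∀ a b → reduce (lin a b) ≡ (a , b)
reduce-lin a b = cong₂ _,_ (ℤP.+-identityʳ a) (ℤP.+-identityʳ b)

reduce-shift : ∀ p → reduce (0ℤ ∷ p) ≡ swap (reduce p)
reduce-shift p = cong₂ _,_ (ℤP.+-identityˡ (proj₂ (reduce p))) refl

reduce-qpow-* : ∀ m p → reduce (qpow m *ₚ p) ≡ q^ m · reduce p
reduce-qpow-* zero    p = reduce-cong (*ₚ-identityˡ p)
reduce-qpow-* (suc m) p = begin
  reduce (qpow (suc m) *ₚ p)    ≡⟨ reduce-cong (shift-*ₚ (qpow m) p) ⟩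
  reduce (0ℤ ∷ (qpow m *ₚ p))   ≡⟨ reduce-shift (qpow m *ₚ p) ⟩
  swap (reduce (qpow m *ₚ p))   ≡⟨ cong swap (reduce-qpow-* m p) ⟩
  swap (q^ m · reduce p)        ∎
  where open ≡-Reasoning

X : Poly
X = qpow 1

X*ₚ : ∀ p → X *ₚ p ≋ 0ℤ ∷ p
X*ₚ p = ≋-trans (shift-*ₚ (qpow 0) p) (∷-cong refl (*ₚ-identityˡ p))

∷-as-sum : ∀ a p → a ∷ p ≋ const a +ₚ X *ₚ p
∷-as-sum a p = ≋-sym (≋-trans (+ₚ-cong (≋-refl {const a}) (X*ₚ p)) (∷-cong (ℤP.+-identityʳ a) ≋-refl))

lin-as-sum : ∀ a b → lin a b ≋ const a +ₚ X *ₚ const b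
lin-as-sum a b = ∷-as-sum a (const b)

q²-1-as-poly : q²-1 ≋ X *ₚ X -ₚ one
q²-1-as-poly = +ₚ-cong (≋-sym (qpow-+ 1 1)) (≋-refl {negₚ one})

-- Every polynomial is congruent to its reduction modulo q² - 1: peeling off the
-- constant term,  a + q·p ≡ a + q·(x + y q) = (a + y) + x q + y (q² - 1).
≡-reduceₚ : ∀ p → p ≡ reduceₚ p [modₚ q²-1 ]
≡-reduceₚ [] = [] , coeff-≡ (≋-trans lin00≋0 (≋-sym (*ₚ-zeroʳ q²-1)))
  where
  lin00≋0 : [] -ₚ lin 0ℤ 0ℤ ≋ []
  lin00≋0 = coeffwise λ { zero → refl ; (suc zero) → refl ; (suc (suc i)) → refl }
≡-reduceₚ (a ∷ p) with ≡-reduceₚ p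
... | h , p≡ = X *ₚ h +ₚ const y , coeff-≡ (≋.begin
  (a ∷ p) -ₚ lin (a ℤ.+ y) x
    ≋.≈⟨ +ₚ-cong (∷-as-sum a p) (negₚ-cong (lin-as-sum (a ℤ.+ y) x)) ⟩
  (const a +ₚ X *ₚ p) -ₚ ((const a +ₚ const y) +ₚ X *ₚ const x)
    ≋.≈⟨ regroup (const a) (const x) (const y) p X ⟩
  X *ₚ (p -ₚ (const x +ₚ X *ₚ const y)) +ₚ (X *ₚ X -ₚ one) *ₚ const y
    ≋.≈⟨ +ₚ-cong (CR.*-cong (≋-refl {X}) step) (≋-refl {(X *ₚ X -ₚ one) *ₚ const y}) ⟩
  X *ₚ ((X *ₚ X -ₚ one) *ₚ h) +ₚ (X *ₚ X -ₚ one) *ₚ const y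
    ≋.≈⟨ factor h (const y) X ⟩
  (X *ₚ X -ₚ one) *ₚ (X *ₚ h +ₚ const y)
    ≋.≈⟨ CR.*-cong q²-1-as-poly (≋-refl {X *ₚ h +ₚ const y}) ⟨
  q²-1 *ₚ (X *ₚ h +ₚ const y)
    ≋.∎)
  where
  x y : ℤ
  x = proj₁ (reduce p)
  y = proj₂ (reduce p)
  step : p -ₚ (const x +ₚ X *ₚ const y) ≋ (X *ₚ X -ₚ one) *ₚ h
  step = ≋.begin
    p -ₚ (const x +ₚ X *ₚ const y)  ≋.≈⟨ +ₚ-cong (≋-refl {p}) (negₚ-cong (lin-as-sum x y)) ⟨
    p -ₚ lin x y                    ≋.≈⟨ coeffwise p≡ ⟩
    q²-1 *ₚ h                       ≋.≈⟨ CR.*-cong q²-1-as-poly (≋-refl {h}) ⟩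
    (X *ₚ X -ₚ one) *ₚ h            ≋.∎
  regroup : ∀ A B C P Q → (A +ₚ Q *ₚ P) +ₚ negₚ ((A +ₚ C) +ₚ Q *ₚ B)
                         ≋ Q *ₚ (P +ₚ negₚ (B +ₚ Q *ₚ C)) +ₚ (Q *ₚ Q +ₚ negₚ one) *ₚ C
  regroup = solve-∀ ℤ[q]-solver
  factor : ∀ H C Q → Q *ₚ ((Q *ₚ Q +ₚ negₚ one) *ₚ H) +ₚ (Q *ₚ Q +ₚ negₚ one) *ₚ C
                   ≋ (Q *ₚ Q +ₚ negₚ one) *ₚ (Q *ₚ H +ₚ C)
  factor = solve-∀ ℤ[q]-solver

reduce-≡⇒≡ : ∀ p r → reduce p ≡ reduce r → p ≡ r [modₚ q²-1 ]
reduce-≡⇒≡ p r same with ≡-reduceₚ p | ≡-reduceₚ r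
... | h₁ , p≡ | h₂ , r≡ = h₁ -ₚ h₂ , coeff-≡ (≋.begin
  p -ₚ r                        ≋.≈⟨ difference p r (reduceₚ p) ⟩
  (p -ₚ reduceₚ p) -ₚ (r -ₚ reduceₚ p)
    ≋.≡⟨ cong (λ c → (p -ₚ reduceₚ p) -ₚ (r -ₚ lin (proj₁ c) (proj₂ c))) same ⟩
  (p -ₚ reduceₚ p) -ₚ (r -ₚ reduceₚ r)
    ≋.≈⟨ +ₚ-cong (coeffwise {p -ₚ reduceₚ p} {q²-1 *ₚ h₁} p≡)
                 (negₚ-cong (coeffwise {r -ₚ reduceₚ r} {q²-1 *ₚ h₂} r≡)) ⟩
  q²-1 *ₚ h₁ -ₚ q²-1 *ₚ h₂      ≋.≈⟨ factor q²-1 h₁ h₂ ⟩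
  q²-1 *ₚ (h₁ -ₚ h₂)            ≋.∎)
  where
  difference : ∀ P R L → P +ₚ negₚ R ≋ (P +ₚ negₚ L) +ₚ negₚ (R +ₚ negₚ L)
  difference = solve-∀ ℤ[q]-solver
  factor : ∀ Q H₁ H₂ → Q *ₚ H₁ +ₚ negₚ (Q *ₚ H₂) ≋ Q *ₚ (H₁ +ₚ negₚ H₂)
  factor = solve-∀ ℤ[q]-solver

q^-⊕ : ∀ m x y → q^ m · (x ⊕ y) ≡ q^ m · x ⊕ q^ m · y
q^-⊕ zero    x y = refl
q^-⊕ (suc m) x y = cong swap (q^-⊕ m x y)

q^-0² : ∀ m → q^ m · 0² ≡ 0²
q^-0² zero    = refl
q^-0² (suc m) = cong swap (q^-0² m)

q^-swap : ∀ m x → q^ m · swap x ≡ swap (q^ m · x)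
q^-swap zero    x = refl
q^-swap (suc m) x = cong swap (q^-swap m x)

q^-involutive : ∀ m x → q^ m · (q^ m · x) ≡ x
q^-involutive zero    x = refl
q^-involutive (suc m) x = begin
  swap (q^ m · swap (q^ m · x))   ≡⟨ cong swap (q^-swap m (q^ m · x)) ⟩
  swap (swap (q^ m · (q^ m · x))) ≡⟨ cong (swap ∘ swap) (q^-involutive m x) ⟩
  x                               ∎
  where open ≡-Reasoning

total : ℤ² → ℤ
total (a , b) = a ℤ.+ b

total-⊕ : ∀ x y → total (x ⊕ y) ≡ total x ℤ.+ total y
total-⊕ (a , b) (c , d) = ℤ-interchange a c b d

total-q^ : ∀ m x → total (q^ m · x) ≡ total x
total-q^ zero    x = refl
total-q^ (suc m) x = trans (ℤP.+-comm (proj₂ (q^ m · x)) (proj₁ (q^ m · x))) (total-q^ m x)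

q^-+ : ∀ a b x → q^ (a ℕ.+ b) · x ≡ q^ a · (q^ b · x)
q^-+ zero    b x = refl
q^-+ (suc a) b x = cong swap (q^-+ a b x)

q^-comm : ∀ a b x → q^ a · (q^ b · x) ≡ q^ b · (q^ a · x)
q^-comm a b x = begin
  q^ a · (q^ b · x)   ≡⟨ q^-+ a b x ⟨
  q^ (a ℕ.+ b) · x    ≡⟨ cong (q^_· x) (ℕP.+-comm a b) ⟩
  q^ (b ℕ.+ a) · x    ≡⟨ q^-+ b a x ⟩
  q^ b · (q^ a · x)   ∎
  where open ≡-Reasoning

⊕-comm : ∀ x y → x ⊕ y ≡ y ⊕ x
⊕-comm (a , b) (c , d) = cong₂ _,_ (ℤP.+-comm a c) (ℤP.+-comm b d)

⊕-assoc : ∀ x y z → (x ⊕ y) ⊕ z ≡ x ⊕ (y ⊕ z)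
⊕-assoc (a , b) (c , d) (e , f) = cong₂ _,_ (ℤP.+-assoc a c e) (ℤP.+-assoc b d f)

⊕-identityˡ : ∀ x → 0² ⊕ x ≡ x
⊕-identityˡ (a , b) = cong₂ _,_ (ℤP.+-identityˡ a) (ℤP.+-identityˡ b)

Σ² : ∀ {A : Set} → (A → ℤ²) → List A → ℤ²
Σ² w []       = 0²
Σ² w (x ∷ xs) = w x ⊕ Σ² w xs

Σ²-++ : ∀ {A : Set} (w : A → ℤ²) xs ys → Σ² w (xs ++ ys) ≡ Σ² w xs ⊕ Σ² w ys
Σ²-++ w []       ys = sym (⊕-identityˡ (Σ² w ys))
Σ²-++ w (x ∷ xs) ys = trans (cong (w x ⊕_) (Σ²-++ w xs ys)) (sym (⊕-assoc (w x) (Σ² w xs) (Σ² w ys)))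

Σ²-map : ∀ {A B : Set} (w : B → ℤ²) (f : A → B) xs → Σ² w (map f xs) ≡ Σ² (w ∘ f) xs
Σ²-map w f []       = refl
Σ²-map w f (x ∷ xs) = cong (w (f x) ⊕_) (Σ²-map w f xs)

Σ²-zero : ∀ {A : Set} (w : A → ℤ²) → (∀ x → w x ≡ 0²) → ∀ xs → Σ² w xs ≡ 0²
Σ²-zero w w≡0 []       = refl
Σ²-zero w w≡0 (x ∷ xs) = cong₂ _⊕_ (w≡0 x) (Σ²-zero w w≡0 xs)

Σ²-q^ : ∀ {A : Set} m (w v : A → ℤ²) → (∀ x → w x ≡ q^ m · v x) → ∀ xs → Σ² w xs ≡ q^ m · Σ² v xs
Σ²-q^ m w v w≡ []       = sym (q^-0² m)
Σ²-q^ m w v w≡ (x ∷ xs) = trans (cong₂ _⊕_ (w≡ x) (Σ²-q^ m w v w≡ xs)) (sym (q^-⊕ m (v x) (Σ² v xs)))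

gaussMod : ℕ → ℕ → ℤ²
gaussMod n k = reduce (gauss n k)

gaussMod-pascal : ∀ n k → gaussMod (suc n) (suc k) ≡ gaussMod n k ⊕ q^ suc k · gaussMod n (suc k)
gaussMod-pascal n k = trans (reduce-+ (gauss n k) (qpow (suc k) *ₚ gauss n (suc k)))
                            (cong (gaussMod n k ⊕_) (reduce-qpow-* (suc k) (gauss n (suc k))))

-- At q = 1 the Gaussian binomial is the ordinary binomial coefficient.
gaussMod-total : ∀ n k → total (gaussMod n k) ≡ + (n C k)
gaussMod-total n       zero    = refl
gaussMod-total zero    (suc k) = refl
gaussMod-total (suc n) (suc k) = begin
  total (gaussMod (suc n) (suc k))
    ≡⟨ cong total (gaussMod-pascal n k) ⟩
  total (gaussMod n k ⊕ q^ suc k · gaussMod n (suc k))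
    ≡⟨ total-⊕ (gaussMod n k) (q^ suc k · gaussMod n (suc k)) ⟩
  total (gaussMod n k) ℤ.+ total (q^ suc k · gaussMod n (suc k))
    ≡⟨ cong₂ ℤ._+_ (gaussMod-total n k) (trans (total-q^ (suc k) _) (gaussMod-total n (suc k))) ⟩
  + (n C k) ℤ.+ + (n C suc k)
    ≡⟨ ℤP.pos-+ (n C k) (n C suc k) ⟨
  + (n C k ℕ.+ n C suc k)
    ≡⟨ cong +_ (nCk+nC[k+1]≡[n+1]C[k+1] n k) ⟩
  + (suc n C suc k)
    ∎
  where open ≡-Reasoning

-- Applying the q-Pascal recursion twice; the middle term of the inner step
-- is multiplied by q^(j+1) twice and so returns unchanged.
gaussMod-pascal² : ∀ m j → gaussMod (suc (suc m)) (suc j)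
                           ≡ gaussMod (suc m) j ⊕ (q^ suc j · gaussMod m j ⊕ gaussMod m (suc j))
gaussMod-pascal² m j = begin
  gaussMod (suc (suc m)) (suc j)
    ≡⟨ gaussMod-pascal (suc m) j ⟩
  gaussMod (suc m) j ⊕ q^ suc j · gaussMod (suc m) (suc j)
    ≡⟨ cong (λ x → gaussMod (suc m) j ⊕ q^ suc j · x) (gaussMod-pascal m j) ⟩
  gaussMod (suc m) j ⊕ q^ suc j · (gaussMod m j ⊕ q^ suc j · gaussMod m (suc j))
    ≡⟨ cong (gaussMod (suc m) j ⊕_) (q^-⊕ (suc j) (gaussMod m j) _) ⟩
  gaussMod (suc m) j ⊕ (q^ suc j · gaussMod m j ⊕ q^ suc j · (q^ suc j · gaussMod m (suc j)))
    ≡⟨ cong (λ x → gaussMod (suc m) j ⊕ (q^ suc j · gaussMod m j ⊕ x)) (q^-involutive (suc j) _) ⟩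
  gaussMod (suc m) j ⊕ (q^ suc j · gaussMod m j ⊕ gaussMod m (suc j))
    ∎
  where open ≡-Reasoning

-- The even part of the reduction of [n k]_q is Losanitsch's L(n,k): the
-- two-step recursion above is exactly the defining recursion of L, because
-- q^(j+1)·x and q^(j+2)·x together contribute the total of x, a binomial.
gaussMod-L : ∀ n k → proj₁ (gaussMod n k) ≡ + L n k
gaussMod-L zero          zero          = refl
gaussMod-L zero          (suc k)       = refl
gaussMod-L (suc zero)    zero          = refl
gaussMod-L (suc zero)    (suc zero)    = refl
gaussMod-L (suc zero)    (suc (suc k)) = cong proj₁ (reduce-cong (*ₚ-zeroʳ (qpow (suc (suc k)))))
gaussMod-L (suc (suc m)) zero          = gaussMod-L m zero
gaussMod-L (suc (suc m)) (suc zero)    = begin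
  proj₁ (gaussMod (suc (suc m)) 1)
    ≡⟨ cong proj₁ (gaussMod-pascal² m 0) ⟩
  1ℤ ℤ.+ (0ℤ ℤ.+ proj₁ (gaussMod m 1))
    ≡⟨ cong (λ x → 1ℤ ℤ.+ x) (trans (ℤP.+-identityˡ _) (gaussMod-L m 1)) ⟩
  + 1 ℤ.+ + L m 1
    ≡⟨ ℤP.+-comm (+ 1) (+ L m 1) ⟩
  + L m 1 ℤ.+ + (m C 0)
    ≡⟨ ℤP.pos-+ (L m 1) (m C 0) ⟨
  + L (suc (suc m)) 1
    ∎
  where open ≡-Reasoning
gaussMod-L (suc (suc m)) (suc (suc j)) = begin
  proj₁ (gaussMod (suc (suc m)) (suc (suc j)))
    ≡⟨ cong proj₁ (gaussMod-pascal² m (suc j)) ⟩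
  proj₁ (gaussMod (suc m) (suc j)) ℤ.+ (proj₁ (q^ suc (suc j) · μ) ℤ.+ ℓ₂)
    ≡⟨ cong (λ x → proj₁ x ℤ.+ (proj₁ (q^ suc (suc j) · μ) ℤ.+ ℓ₂)) (gaussMod-pascal m j) ⟩
  ℓ₀ ℤ.+ proj₁ (q^ suc j · μ) ℤ.+ (proj₁ (q^ suc (suc j) · μ) ℤ.+ ℓ₂)
    ≡⟨ regroup ℓ₀ (proj₁ (q^ suc j · μ)) (proj₁ (q^ suc (suc j) · μ)) ℓ₂ ⟩
  ℓ₂ ℤ.+ total (q^ suc j · μ) ℤ.+ ℓ₀
    ≡⟨ cong₂ (λ x y → x ℤ.+ y ℤ.+ ℓ₀) (gaussMod-L m (suc (suc j))) (trans (total-q^ (suc j) μ) (gaussMod-total m (suc j))) ⟩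
  + L m (suc (suc j)) ℤ.+ + (m C suc j) ℤ.+ ℓ₀
    ≡⟨ cong₂ ℤ._+_ (sym (ℤP.pos-+ (L m (suc (suc j))) (m C suc j))) (gaussMod-L m j) ⟩
  + (L m (suc (suc j)) ℕ.+ m C suc j) ℤ.+ + L m j
    ≡⟨ ℤP.pos-+ (L m (suc (suc j)) ℕ.+ m C suc j) (L m j) ⟨
  + L (suc (suc m)) (suc (suc j))
    ∎
  where
  open ≡-Reasoning
  μ : ℤ²
  μ = gaussMod m (suc j)
  ℓ₀ ℓ₂ : ℤ
  ℓ₀ = proj₁ (gaussMod m j)
  ℓ₂ = proj₁ (gaussMod m (suc (suc j)))
  regroup : ∀ a b c d → a ℤ.+ b ℤ.+ (c ℤ.+ d) ≡ d ℤ.+ (b ℤ.+ c) ℤ.+ a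
  regroup = ℤ-Solver.solve-∀

gaussMod-Losanitsch : ∀ n k → gaussMod n k ≡ (+ L n k , Lbar n k)
gaussMod-Losanitsch n k = cong₂ _,_ (gaussMod-L n k) (begin
  ℓ₁                                  ≡⟨ xyx⁻¹≈y ℓ₀ ℓ₁ ⟨
  (ℓ₀ ℤ.+ ℓ₁) ℤ.- ℓ₀                  ≡⟨ cong₂ ℤ._-_ (gaussMod-total n k) (gaussMod-L n k) ⟩
  + (n C k) ℤ.- + L n k               ∎)
  where
  open ≡-Reasoning
  ℓ₀ ℓ₁ : ℤ
  ℓ₀ = proj₁ (gaussMod n k)
  ℓ₁ = proj₂ (gaussMod n k)

monomial : ℕ → ℤ²
monomial m = q^ m · (1ℤ , 0ℤ)

monomial-even : ∀ m → isEven m ≡ true → monomial m ≡ (1ℤ , 0ℤ)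
monomial-even zero          _    = refl
monomial-even (suc (suc m)) even = monomial-even m even

monomial-odd : ∀ m → isEven m ≡ false → monomial m ≡ (0ℤ , 1ℤ)
monomial-odd (suc zero)    _   = refl
monomial-odd (suc (suc m)) odd = monomial-odd m odd

weight : ∀ {n} → ℕ → ℕ → Vec Bool n → ℤ²
weight c k s = if card s ℕ.≡ᵇ k then monomial (elemSumFrom c s) else 0²

subsetSum : ∀ {n} → ℕ → ℕ → List (Vec Bool n) → ℤ²
subsetSum c k = Σ² (weight c k)

-- Its two components count the k-subsets in xs of even and of odd sum,
-- since q^m reduces to (1,0) or (0,1) according to the parity of m.
count-by-parity : ∀ {n} k (xs : List (Vec Bool n)) →
  (+ length (filter (λ s → card s ℕ.≟ k) (filter (λ s → isEven (elemSum s) B.≟ true) xs)) ,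
   + length (filter (λ s → card s ℕ.≟ k) (filter (λ s → isEven (elemSum s) B.≟ false) xs)))
  ≡ subsetSum 1 k xs
count-by-parity k [] = refl
count-by-parity k (s ∷ xs) with isEven (elemSum s) in parity
... | true with card s ℕ.≡ᵇ k
...   | true rewrite monomial-even (elemSum s) parity = cong ((1ℤ , 0ℤ) ⊕_) (count-by-parity k xs)
...   | false = cong (0² ⊕_) (count-by-parity k xs)
count-by-parity k (s ∷ xs) | false with card s ℕ.≡ᵇ k
...   | true rewrite monomial-odd (elemSum s) parity = cong ((0ℤ , 1ℤ) ⊕_) (count-by-parity k xs)
...   | false = cong (0² ⊕_) (count-by-parity k xs)

elemSumFrom-suc : ∀ {n} c (s : Vec Bool n) → elemSumFrom (suc c) s ≡ card s ℕ.+ elemSumFrom c s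
elemSumFrom-suc c []          = refl
elemSumFrom-suc c (false ∷ s) = elemSumFrom-suc (suc c) s
elemSumFrom-suc c (true ∷ s)  = cong suc (trans (cong (c ℕ.+_) (elemSumFrom-suc (suc c) s))
                                               (ℕ-x+[y+z]≡y+[x+z] c (card s) (elemSumFrom (suc c) s)))

≡ᵇ-true : ∀ m n → (m ℕ.≡ᵇ n) ≡ true → m ≡ n
≡ᵇ-true m n eq = ℕP.≡ᵇ⇒≡ m n (Equivalence.from T-≡ eq)

weight-offset : ∀ {n} c k (s : Vec Bool n) → weight (suc c) k s ≡ q^ k · weight c k s
weight-offset c k s with card s ℕ.≡ᵇ k in size
... | true  = begin
  monomial (elemSumFrom (suc c) s)          ≡⟨ cong monomial (elemSumFrom-suc c s) ⟩
  monomial (card s ℕ.+ elemSumFrom c s)     ≡⟨ q^-+ (card s) (elemSumFrom c s) (1ℤ , 0ℤ) ⟩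
  q^ card s · monomial (elemSumFrom c s)    ≡⟨ cong (q^_· monomial (elemSumFrom c s)) (≡ᵇ-true (card s) k size) ⟩
  q^ k · monomial (elemSumFrom c s)         ∎
  where open ≡-Reasoning
... | false = sym (q^-0² k)

weight-with : ∀ {n} c k (s : Vec Bool n) → weight c (suc k) (true ∷ s) ≡ q^ c · weight (suc c) k s
weight-with c k s with card s ℕ.≡ᵇ k
... | true  = q^-+ c (elemSumFrom (suc c) s) (1ℤ , 0ℤ)
... | false = sym (q^-0² c)

subsetSum-split : ∀ n c k → subsetSum c k (allSubsets (suc n))
                            ≡ q^ k · subsetSum c k (allSubsets n) ⊕ Σ² (weight c k ∘ (true ∷_)) (allSubsets n)
subsetSum-split n c k = begin
  Σ² (weight c k) (map (false ∷_) S ++ map (true ∷_) S)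
    ≡⟨ Σ²-++ (weight c k) (map (false ∷_) S) (map (true ∷_) S) ⟩
  Σ² (weight c k) (map (false ∷_) S) ⊕ Σ² (weight c k) (map (true ∷_) S)
    ≡⟨ cong₂ _⊕_ (Σ²-map (weight c k) (false ∷_) S) (Σ²-map (weight c k) (true ∷_) S) ⟩
  Σ² (weight (suc c) k) S ⊕ Σ² (weight c k ∘ (true ∷_)) S
    ≡⟨ cong (_⊕ Σ² (weight c k ∘ (true ∷_)) S) (Σ²-q^ k (weight (suc c) k) (weight c k) (weight-offset c k) S) ⟩
  q^ k · Σ² (weight c k) S ⊕ Σ² (weight c k ∘ (true ∷_)) S
    ∎
  where
  open ≡-Reasoning
  S = allSubsets n

triangular-suc : ∀ k → suc (suc k) C 2 ≡ suc k ℕ.+ suc k C 2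
triangular-suc k = trans (sym (nCk+nC[k+1]≡[n+1]C[k+1] (suc k) 1)) (cong (ℕ._+ suc k C 2) (nC1≡n (suc k)))

-- Σ_{S ⊆ {1..n}, |S| = k} q^(ΣS) = q^T(k) [n k]_q, here modulo q² - 1:
-- both sides satisfy the same recursion in n.
subsetSum-gauss : ∀ n k → subsetSum 1 k (allSubsets n) ≡ q^ (suc k C 2) · gaussMod n k
subsetSum-gauss zero    zero    = refl
subsetSum-gauss zero    (suc k) = sym (q^-0² (suc (suc k) C 2))
subsetSum-gauss (suc n) zero    = begin
  subsetSum 1 0 (allSubsets (suc n))
    ≡⟨ subsetSum-split n 1 0 ⟩
  subsetSum 1 0 (allSubsets n) ⊕ Σ² (weight 1 0 ∘ (true ∷_)) (allSubsets n)
    ≡⟨ cong₂ _⊕_ (subsetSum-gauss n 0) (Σ²-zero (weight 1 0 ∘ (true ∷_)) (λ _ → refl) (allSubsets n)) ⟩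
  gaussMod n 0 ⊕ 0²
    ≡⟨ trans (⊕-comm (gaussMod n 0) 0²) (⊕-identityˡ (gaussMod n 0)) ⟩
  gaussMod n 0
    ∎
  where open ≡-Reasoning
subsetSum-gauss (suc n) (suc k) = begin
  subsetSum 1 (suc k) (allSubsets (suc n))
    ≡⟨ subsetSum-split n 1 (suc k) ⟩
  q^ suc k · subsetSum 1 (suc k) S ⊕ Σ² (weight 1 (suc k) ∘ (true ∷_)) S
    ≡⟨ cong (q^ suc k · subsetSum 1 (suc k) S ⊕_) (Σ²-q^ 1 _ (weight 2 k) (weight-with 1 k) S) ⟩
  q^ suc k · subsetSum 1 (suc k) S ⊕ q^ 1 · subsetSum 2 k S
    ≡⟨ cong₂ (λ x y → q^ suc k · x ⊕ q^ 1 · y) (subsetSum-gauss n (suc k))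
             (Σ²-q^ k (weight 2 k) (weight 1 k) (weight-offset 1 k) S) ⟩
  q^ suc k · (q^ T′ · gaussMod n (suc k)) ⊕ q^ 1 · (q^ k · subsetSum 1 k S)
    ≡⟨ cong (λ x → q^ suc k · (q^ T′ · gaussMod n (suc k)) ⊕ q^ 1 · (q^ k · x)) (subsetSum-gauss n k) ⟩
  q^ suc k · (q^ T′ · gaussMod n (suc k)) ⊕ q^ 1 · (q^ k · (q^ T · gaussMod n k))
    ≡⟨ cong₂ _⊕_ (q^-comm (suc k) T′ _) lower-term ⟩
  q^ T′ · (q^ suc k · gaussMod n (suc k)) ⊕ q^ T′ · gaussMod n k
    ≡⟨ ⊕-comm (q^ T′ · (q^ suc k · gaussMod n (suc k))) (q^ T′ · gaussMod n k) ⟩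
  q^ T′ · gaussMod n k ⊕ q^ T′ · (q^ suc k · gaussMod n (suc k))
    ≡⟨ q^-⊕ T′ (gaussMod n k) _ ⟨
  q^ T′ · (gaussMod n k ⊕ q^ suc k · gaussMod n (suc k))
    ≡⟨ cong (q^ T′ ·_) (gaussMod-pascal n k) ⟨
  q^ T′ · gaussMod (suc n) (suc k)
    ∎
  where
  open ≡-Reasoning
  S = allSubsets n
  T T′ : ℕ
  T  = suc k C 2
  T′ = suc (suc k) C 2
  lower-term : q^ 1 · (q^ k · (q^ T · gaussMod n k)) ≡ q^ T′ · gaussMod n k
  lower-term = begin
    q^ 1 · (q^ k · (q^ T · gaussMod n k))   ≡⟨ cong (q^ 1 ·_) (q^-+ k T _) ⟨
    q^ suc (k ℕ.+ T) · gaussMod n k         ≡⟨ cong (q^_· gaussMod n k) (triangular-suc k) ⟨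
    q^ T′ · gaussMod n k                    ∎

theorem4p1 : (n k : ℕ) → k ≤ n →
    Σ Poly (λ G → IsGaussianBinomial n k G
      × (lin (+ e n k) (+ o n k) ≡ qpow (suc k C 2) *ₚ G [modₚ q²-1 ])
      × (lin (+ L n k) (Lbar n k) ≡ G [modₚ q²-1 ]))
theorem4p1 n k k≤n = gauss n k , gauss-isGaussianBinomial k≤n , parity-congruence , losanitsch-congruence
  where
  open ≡-Reasoning
  parity-congruence : lin (+ e n k) (+ o n k) ≡ qpow (suc k C 2) *ₚ gauss n k [modₚ q²-1 ]
  parity-congruence = reduce-≡⇒≡ (lin (+ e n k) (+ o n k)) (qpow (suc k C 2) *ₚ gauss n k) (begin
    reduce (lin (+ e n k) (+ o n k))        ≡⟨ reduce-lin (+ e n k) (+ o n k) ⟩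
    (+ e n k , + o n k)                     ≡⟨ count-by-parity k (allSubsets n) ⟩
    subsetSum 1 k (allSubsets n)            ≡⟨ subsetSum-gauss n k ⟩
    q^ (suc k C 2) · gaussMod n k           ≡⟨ reduce-qpow-* (suc k C 2) (gauss n k) ⟨
    reduce (qpow (suc k C 2) *ₚ gauss n k)  ∎)
  losanitsch-congruence : lin (+ L n k) (Lbar n k) ≡ gauss n k [modₚ q²-1 ]
  losanitsch-congruence = reduce-≡⇒≡ (lin (+ L n k) (Lbar n k)) (gauss n k)
    (trans (reduce-lin (+ L n k) (Lbar n k)) (sym (gaussMod-Losanitsch n k)))
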